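{- Let $D\in\mathcal{S}_n^k$ and let $h:E(D)\to\mathcal{T}^q_\sigma$ be any function, where every member of $\mathcal{T}^q_\sigma$ has $p$ vertices. Then there exist a family $\mathcal{T}^q_{3(p+q+1)-\sigma}$ of edge-magic labeled digraphs with a common vertex set of $p$ elements, $q$ arcs each and magic sum $3(p+q+1)-\sigma$, and a function $h^c:E(D^c)\to\mathcal{T}^q_{3(p+q+1)-\sigma}$ such that $D\otimes_h\mathcal{T}^q_\sigma\cong D^c\otimes_{h^c}\mathcal{T}^q_{3(p+q+1)-\sigma}$ and $\widetilde{h^c}\simeq\overline{\widetilde h}$, where $\overline{\widetilde h}$ is the complementary labeling of the induced labeling $\widetilde h$ of $D\otimes_h\mathcal{T}^q_\sigma$ and $\widetilde{h^c}$ is the induced labeling of $D^c\otimes_{h^c}\mathcal{T}^q_{3(p+q+1)-\sigma}$.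
   Context: Digraphs may have loops but no multiple arcs. $[a,b]=\{a,\dots,b\}$. An edge-magic labeling of a $(p,q)$-(di)graph $G$ is a bijection $f:V(G)\cup E(G)\to[1,p+q]$ with $f(x)+f(xy)+f(y)=\mathrm{val}(f)$ constant over edges (magic sum); super if $f(V(G))=[1,p]$. Complementary labeling: $\overline f(x)=p'+q'+1-f(x)$ for a $(p',q')$-graph. $\mathcal{S}_n^k$: the set of digraphs $D$ with vertex set $[1,n]$ (vertices named by super edge-magic labels), exactly $n$ arcs, and $\{i+j:(i,j)\in E(D)\}=[k,k+n-1]$. For $D\in\mathcal{S}_n^k$, $D^c$ is the digraph on $[1,n]$ with $(i,j)\in E(D^c)$ iff $(n+1-i,n+1-j)\in E(D)$; $D^c\cong D$ and $D^c\in\mathcal{S}_n^{n+3-k}$. A family $\mathcal{T}^q_\sigma$ consists of edge-magic labeled digraphs $F$, all with the same vertex set $V$ (each vertex named by its label), $|E(F)|=q$, and magic sum $\sigma$. For $D\in\mathcal{S}_n^{k}$ and $h:E(D)\to\mathcal{T}^q_\sigma$ with $|V|=p$, $D\otimes_h\mathcal{T}^q_\sigma$ has vertex set $V(D)\times V$ with arc $((i,a),(j,b))$ iff $(i,j)\in E(D)$ and $(a,b)\in E(h(i,j))$, and its induced labeling is $\widetilde h(i,a)=(p+q)(i-1)+a$, $\widetilde h((i,a),(j,b))=(p+q)(k+n-(i+j)-1)+(\sigma-(a+b))$, an edge-magic labeling (for $D^c$ use $n+3-k$ in place of $k$ and $3(p+q+1)-\sigma$ in place of $\sigma$). $\simeq$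 means there is a digraph isomorphism carrying one labeling to the other. -}

module Defs where

open import Data.Nat using (ℕ; suc; _+_; _*_; _∸_; _≤_; _<_)
open import Data.Product using (_×_; _,_; Σ; ∃; ∃-syntax)
open import Data.List using (List; map; upTo; concatMap; length; _++_)
open import Data.List.Membership.Propositional using (_∈_)
open import Data.List.Relation.Unary.Unique.Propositional using (Unique)
open import Data.List.Relation.Binary.Permutation.Propositional using (_↭_)
open import Relation.Binary.PropositionalEquality using (_≡_)

interval : ℕ → ℕ → List ℕ
interval a b = map (a +_) (upTo (suc b ∸ a))

record Digraph (A : Set) : Set where
  constructor digraph
  field
    verts : List A
    arcs  : List (A × A)
open Digraph public

WellFormed : {A : Set} → Digraph A → Set
WellFormed G =
  Unique (verts G) × Unique (arcs G) ×
  (∀ {x y} → (x , y) ∈ arcs G → x ∈ verts G × y ∈ verts G)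

record Labeling (A : Set) : Set where
  constructor labeling
  field
    vlab : A → ℕ
    alab : A → A → ℕ
open Labeling public

arcLabels : {A : Set} → Digraph A → Labeling A → List ℕ
arcLabels G f = map (λ { (x , y) → alab f x y }) (arcs G)

IsEdgeMagic : {A : Set} → Digraph A → Labeling A → ℕ → Set
IsEdgeMagic G f σ =
  (map (vlab f) (verts G) ++ arcLabels G f)
     ↭ interval 1 (length (verts G) + length (arcs G))
  × (∀ {x y} → (x , y) ∈ arcs G → vlab f x + alab f x y + vlab f y ≡ σ)

complement : {A : Set} → Digraph A → Labeling A → Labeling A
complement G f = labeling
  (λ x → suc (length (verts G) + length (arcs G)) ∸ vlab f x)
  (λ x y → suc (length (verts G) + length (arcs G)) ∸ alab f x y)

IsIso : {A B : Set} → Digraph A → Digraph B → (A → B) → Set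
IsIso {A} {B} G H φ =
  (∀ {x} → x ∈ verts G → φ x ∈ verts H) ×
  (∀ {x y} → x ∈ verts G → y ∈ verts G → φ x ≡ φ y → x ≡ y) ×
  (∀ {y} → y ∈ verts H → ∃[ x ] (x ∈ verts G × φ x ≡ y)) ×
  (∀ {x y} → x ∈ verts G → y ∈ verts G →
     ((x , y) ∈ arcs G → (φ x , φ y) ∈ arcs H) ×
     ((φ x , φ y) ∈ arcs H → (x , y) ∈ arcs G))

Carries : {A B : Set} → Digraph A → (A → B) → Labeling A → Labeling B → Set
Carries G φ f g =
  (∀ {x} → x ∈ verts G → vlab g (φ x) ≡ vlab f x) ×
  (∀ {x y} → (x , y) ∈ arcs G → alab g (φ x) (φ y) ≡ alab f x y)

-- The class S_n^k (vertices [1,n] named by their super edge-magic labels)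

digraphOn : ℕ → List (ℕ × ℕ) → Digraph ℕ
digraphOn n E = digraph (interval 1 n) E

InS : ℕ → ℕ → List (ℕ × ℕ) → Set
InS n k E =
  WellFormed (digraphOn n E) × length E ≡ n ×
  (∀ {i j} → (i , j) ∈ E → k ≤ i + j × i + j < k + n) ×
  (∀ s → k ≤ s → s < k + n → ∃[ i ] ∃[ j ] ((i , j) ∈ E × i + j ≡ s))

compArcs : ℕ → List (ℕ × ℕ) → List (ℕ × ℕ)
compArcs n E = map (λ { (i , j) → (suc n ∸ i , suc n ∸ j) }) E

-- Members of a family T^q_σ with common vertex set V
-- (vertices named by their labels, so the vertex labeling is the identity)

record Member : Set where
  constructor member
  field
    marcs : List (ℕ × ℕ)
    mlab  : ℕ → ℕ → ℕ
open Member public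

memberDigraph : List ℕ → Member → Digraph ℕ
memberDigraph V F = digraph V (marcs F)

memberLabeling : Member → Labeling ℕ
memberLabeling F = labeling (λ a → a) (mlab F)

InFamily : List ℕ → ℕ → ℕ → Member → Set
InFamily V q σ F =
  WellFormed (memberDigraph V F) × length (marcs F) ≡ q ×
  IsEdgeMagic (memberDigraph V F) (memberLabeling F) σ

IsVertexSet : ℕ → List ℕ → Set
IsVertexSet p V = Unique V × length V ≡ p

product : ℕ → List (ℕ × ℕ) → List ℕ → (ℕ → ℕ → Member) → Digraph (ℕ × ℕ)
product n E V h = digraph
  (concatMap (λ i → map (λ a → (i , a)) V) (interval 1 n))
  (concatMap (λ { (i , j) → map (λ { (a , b) → ((i , a) , (j , b)) }) (marcs (h i j)) }) E)

induced : (n k p q σ : ℕ) → Labeling (ℕ × ℕ)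
induced n k p q σ = labeling
  (λ { (i , a) → (p + q) * (i ∸ 1) + a })
  (λ { (i , a) (j , b) → (p + q) * (k + n ∸ (i + j) ∸ 1) + (σ ∸ (a + b)) })

-- The reflection x ↦ M + 1 − x of [1, M] (mirror M below) is an involution permuting [1, M],
-- and both sides of the statement are built from it. Complementing the labels of a member of
-- the family and renaming its vertices by the same reflection gives again an edge-magic
-- labeling, with magic sum 3(p+q+1) − σ. In the product, an induced label (p+q)(x − 1) + y
-- records a block x ∈ [1, n] and a label y ∈ [1, p+q] of a member, and complementing with
-- respect to n(p+q) reflects both: block n + 1 − x, label p + q + 1 − y. A vertex (i, a) lies
-- in block i, reflected by the renaming i ↦ n + 1 − i of D^c; an arc (i, j) of D lies in block
-- k + n − (i + j), and reflecting i and j gives (n+3−k) + n − ((n+1−i) + (n+1−j)), its block as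
-- an arc of D^c ∈ S_n^{n+3−k}. So φ(i, a) = (n + 1 − i, p + q + 1 − a) is the isomorphism.

module Submission where

open import Defs
open import Data.Nat using (ℕ; zero; suc; _+_; _*_; _∸_; _≤_; _<_; z≤n; s≤s)
open import Data.Nat.Properties
open import Algebra.Properties.CommutativeSemigroup +-commutativeSemigroup using (xy∙z≈xz∙y)
open import Data.Nat.Tactic.RingSolver using (solve; solve-∀)
open import Data.List using (List; []; _∷_; map; upTo; downFrom; applyUpTo; concatMap; length; _++_; reverse)
open import Data.List.Properties using (length-map; length-++; length-upTo; map-∘; map-id; map-++; map-cong-local; map-upTo; map-applyUpTo; reverse-map; reverse-upTo)
open import Data.List.Membership.Propositional using (_∈_; find; lose)
open import Data.List.Membership.Propositional.Properties using (∈-map⁺; ∈-map⁻; ∈-concatMap⁺; ∈-concatMap⁻; ∈-++⁺ˡ; ∈-++⁺ʳ; ∈-upTo⁺; ∈-upTo⁻)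
open import Data.List.Relation.Unary.Any using (here; there)
import Data.List.Relation.Unary.All as All
import Data.List.Relation.Unary.All.Properties as All
open import Data.List.Relation.Unary.AllPairs using ([]; _∷_)
open import Data.List.Relation.Unary.Unique.Propositional using (Unique)
open import Data.List.Relation.Binary.Permutation.Propositional using (_↭_; module PermutationReasoning)
open import Data.List.Relation.Binary.Permutation.Propositional.Properties using (map⁺; ∈-resp-↭; ↭-reverse)
open import Data.Product using (_×_; _,_; ∃-syntax; proj₁; proj₂)
open import Relation.Binary.PropositionalEquality

Unique-map⁺-local : ∀ {A B : Set} {f : A → B} {xs : List A} →
  (∀ {x y} → x ∈ xs → y ∈ xs → f x ≡ f y → x ≡ y) → Unique xs → Unique (map f xs)
Unique-map⁺-local inj [] = []
Unique-map⁺-local inj (x∉xs ∷ xs!) =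
  All.map⁺ (All.tabulate λ y∈xs fx≡fy → All.lookup x∉xs y∈xs (inj (here refl) (there y∈xs) fx≡fy))
  ∷ Unique-map⁺-local (λ x∈ y∈ → inj (there x∈) (there y∈)) xs!

∈-map⁻-injective : ∀ {A B : Set} {f : A → B} {x : A} {xs : List A} →
  (∀ {y} → y ∈ xs → f y ≡ f x → y ≡ x) → f x ∈ map f xs → x ∈ xs
∈-map⁻-injective {f = f} {xs = xs} inj fx∈ with ∈-map⁻ f fx∈
... | y , y∈xs , fx≡fy = subst (_∈ xs) (inj y∈xs (sym fx≡fy)) y∈xs

length-concatMap : ∀ {A B : Set} (f : A → List B) (xs : List A) {m} →
  (∀ {x} → x ∈ xs → length (f x) ≡ m) → length (concatMap f xs) ≡ length xs * m
length-concatMap f []       eq = refl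
length-concatMap f (x ∷ xs) eq =
  trans (length-++ (f x)) (cong₂ _+_ (eq (here refl)) (length-concatMap f xs (λ x∈xs → eq (there x∈xs))))

m+n≡o⇒o∸m≡n : ∀ m {n o} → m + n ≡ o → o ∸ m ≡ n
m+n≡o⇒o∸m≡n m {n} refl = m+n∸m≡n m n

m+n+o≡p⇒p∸[m+o]≡n : ∀ {m n o p} → m + n + o ≡ p → p ∸ (m + o) ≡ n
m+n+o≡p⇒p∸[m+o]≡n {m} {n} {o} eq = m+n≡o⇒o∸m≡n (m + o) (trans (xy∙z≈xz∙y m o n) eq)

mirror : ℕ → ℕ → ℕ
mirror M x = suc M ∸ x

+-mirror : ∀ {M x} → x ≤ M → x + mirror M x ≡ suc M
+-mirror x≤M = m+[n∸m]≡n (m≤n⇒m≤1+n x≤M)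

mirror-involutive : ∀ {M x} → x ≤ M → mirror M (mirror M x) ≡ x
mirror-involutive x≤M = m∸[m∸n]≡n (m≤n⇒m≤1+n x≤M)

mirror-injective : ∀ {M x y} → x ≤ M → y ≤ M → mirror M x ≡ mirror M y → x ≡ y
mirror-injective {M} {x} {y} x≤M y≤M eq = begin
  x                     ≡⟨ mirror-involutive x≤M ⟨
  mirror M (mirror M x) ≡⟨ cong (mirror M) eq ⟩
  mirror M (mirror M y) ≡⟨ mirror-involutive y≤M ⟩
  y                     ∎
  where open ≡-Reasoning

∈-interval⁻ : ∀ {n x} → x ∈ interval 1 n → 1 ≤ x × x ≤ n
∈-interval⁻ x∈ with ∈-map⁻ suc x∈
... | y , y∈ , refl = s≤s z≤n , ∈-upTo⁻ y∈

∈-interval⁺ : ∀ {n x} → 1 ≤ x → x ≤ n → x ∈ interval 1 n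
∈-interval⁺ {x = suc x} _ x<n = ∈-map⁺ suc (∈-upTo⁺ x<n)

length-interval : ∀ n → length (interval 1 n) ≡ n
length-interval n = trans (length-map suc (upTo n)) (length-upTo n)

mirror-∈-interval : ∀ {n x} → x ∈ interval 1 n → mirror n x ∈ interval 1 n
mirror-∈-interval {n} x∈ with ∈-interval⁻ x∈
... | s≤s {n = x} _ , x<n = ∈-interval⁺ (m<n⇒0<n∸m x<n) (m∸n≤m n x)

map-∸-upTo : ∀ n → map (n ∸_) (upTo n) ≡ map suc (downFrom n)
map-∸-upTo zero    = refl
map-∸-upTo (suc n) = cong (suc n ∷_) (begin
  map (suc n ∸_) (applyUpTo suc n) ≡⟨ map-applyUpTo suc (suc n ∸_) n ⟩
  applyUpTo (n ∸_) n               ≡⟨ map-upTo (n ∸_) n ⟨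
  map (n ∸_) (upTo n)              ≡⟨ map-∸-upTo n ⟩
  map suc (downFrom n)             ∎)
  where open ≡-Reasoning

map-mirror-interval : ∀ n → map (mirror n) (interval 1 n) ↭ interval 1 n
map-mirror-interval n = begin
  map (mirror n) (map suc (upTo n)) ≡⟨ map-∘ (upTo n) ⟨
  map (n ∸_) (upTo n)               ≡⟨ map-∸-upTo n ⟩
  map suc (downFrom n)              ≡⟨ cong (map suc) (reverse-upTo n) ⟨
  map suc (reverse (upTo n))        ≡⟨ reverse-map suc (upTo n) ⟩
  reverse (map suc (upTo n))        ↭⟨ ↭-reverse (map suc (upTo n)) ⟩
  map suc (upTo n)                  ∎
  where open PermutationReasoning

mirror-magic : ∀ {M a m b σ} → a ≤ M → m ≤ M → b ≤ M → a + m + b ≡ σ →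
  mirror M a + mirror M m + mirror M b ≡ 3 * (M + 1) ∸ σ
mirror-magic {M} {a} {m} {b} a≤M m≤M b≤M refl = sym (m+n≡o⇒o∸m≡n (a + m + b) (begin
  a + m + b + (a′ + m′ + b′)     ≡⟨ regroup a m b a′ m′ b′ ⟩
  (a + a′) + (m + m′) + (b + b′) ≡⟨ cong₂ _+_ (cong₂ _+_ (+-mirror a≤M) (+-mirror m≤M)) (+-mirror b≤M) ⟩
  suc M + suc M + suc M          ≡⟨ solve (M ∷ []) ⟩
  3 * (M + 1)                    ∎))
  where
  open ≡-Reasoning
  a′ = mirror M a
  m′ = mirror M m
  b′ = mirror M b
  regroup : ∀ a m b a′ m′ b′ → a + m + b + (a′ + m′ + b′) ≡ (a + a′) + (m + m′) + (b + b′)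
  regroup = solve-∀

mirror-block : ∀ {n P x y} → 1 ≤ x → x ≤ n → y ≤ P →
  mirror (n * P) (P * (x ∸ 1) + y) ≡ P * (mirror n x ∸ 1) + mirror P y
mirror-block {n} {P} {suc x} {y} _ x<n y≤P = begin
  mirror (n * P) (P * x + y) ≡⟨ m+n≡o⇒o∸m≡n (P * x + y) sum ⟩
  P * u + mirror P y         ≡⟨ cong (λ v → P * v + mirror P y) n∸x∸1≡u ⟨
  P * (n ∸ x ∸ 1) + mirror P y ∎
  where
  open ≡-Reasoning
  u = n ∸ suc x
  1+x+u≡n : suc x + u ≡ n
  1+x+u≡n = m+[n∸m]≡n x<n
  n∸x∸1≡u : n ∸ x ∸ 1 ≡ u
  n∸x∸1≡u = cong (_∸ 1) (m+n≡o⇒o∸m≡n x (trans (+-suc x u) 1+x+u≡n))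
  regroup : ∀ P x u y y′ → P * x + y + (P * u + y′) ≡ P * x + P * u + (y + y′)
  regroup = solve-∀
  collect : ∀ P x u → P * x + P * u + suc P ≡ suc ((suc x + u) * P)
  collect = solve-∀
  sum : P * x + y + (P * u + mirror P y) ≡ suc (n * P)
  sum = begin
    P * x + y + (P * u + mirror P y) ≡⟨ regroup P x u y (mirror P y) ⟩
    P * x + P * u + (y + mirror P y) ≡⟨ cong (P * x + P * u +_) (+-mirror y≤P) ⟩
    P * x + P * u + suc P            ≡⟨ collect P x u ⟩
    suc ((suc x + u) * P)            ≡⟨ cong (λ m → suc (m * P)) 1+x+u≡n ⟩
    suc (n * P)                      ∎

-- Both sides equal 1 + (i + j − k). The two computations abstract the differences into variables
-- so that the ring solver can reorder the sums.
mirror-arcIndex : ∀ {n k i j} → i ≤ n → j ≤ n → k ≤ n + 3 → k ≤ i + j → i + j ≤ k + n →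
  n + 3 ∸ k + n ∸ (mirror n i + mirror n j) ≡ mirror n (k + n ∸ (i + j))
mirror-arcIndex {n} {k} {i} {j} i≤n j≤n k≤n+3 k≤i+j i+j≤k+n =
  trans (index-in-Dᶜ (+-mirror i≤n) (+-mirror j≤n) (m+[n∸m]≡n k≤n+3) (m+[n∸m]≡n k≤i+j))
        (sym (mirror-index-in-D (m+[n∸m]≡n i+j≤k+n) (m+[n∸m]≡n k≤i+j)))
  where
  open ≡-Reasoning
  index-in-Dᶜ : ∀ {i′ j′ w t} → i + i′ ≡ suc n → j + j′ ≡ suc n → k + w ≡ n + 3 → k + t ≡ i + j →
    w + n ∸ (i′ + j′) ≡ suc t
  index-in-Dᶜ {i′} {j′} {w} {t} ii′ jj′ kw kt = m+n≡o⇒o∸m≡n (i′ + j′) (+-cancelˡ-≡ k _ _ (begin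
    k + (i′ + j′ + suc t)   ≡⟨ solve (k ∷ i′ ∷ j′ ∷ t ∷ []) ⟩
    k + t + i′ + j′ + 1     ≡⟨ cong (λ s → s + i′ + j′ + 1) kt ⟩
    i + j + i′ + j′ + 1     ≡⟨ solve (i ∷ j ∷ i′ ∷ j′ ∷ []) ⟩
    (i + i′) + (j + j′) + 1 ≡⟨ cong₂ (λ a b → a + b + 1) ii′ jj′ ⟩
    suc n + suc n + 1       ≡⟨ solve (n ∷ []) ⟩
    n + 3 + n               ≡⟨ cong (_+ n) kw ⟨
    k + w + n               ≡⟨ +-assoc k w n ⟩
    k + (w + n)             ∎))
  mirror-index-in-D : ∀ {u t} → i + j + u ≡ k + n → k + t ≡ i + j → mirror n u ≡ suc t
  mirror-index-in-D {u} {t} su kt = m+n≡o⇒o∸m≡n u (+-cancelˡ-≡ k _ _ (begin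
    k + (u + suc t) ≡⟨ solve (k ∷ u ∷ t ∷ []) ⟩
    suc (k + t + u) ≡⟨ cong (λ s → suc (s + u)) kt ⟩
    suc (i + j + u) ≡⟨ cong suc su ⟩
    suc (k + n)     ≡⟨ +-suc k n ⟨
    k + suc n       ∎))

arcIndex-bounds : ∀ {n k s} → k ≤ s → s < k + n → 1 ≤ k + n ∸ s × k + n ∸ s ≤ n
arcIndex-bounds {n} {k} k≤s s<k+n =
  m<n⇒0<n∸m s<k+n , ≤-trans (∸-monoʳ-≤ (k + n) k≤s) (≤-reflexive (m+n∸m≡n k n))

-- Mirrored members of a family

mirrorArc : ℕ → ℕ × ℕ → ℕ × ℕ
mirrorArc M (a , b) = mirror M a , mirror M b

mirrorArc-injective : ∀ {M a b c d} → a ≤ M × b ≤ M → c ≤ M × d ≤ M →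
  mirrorArc M (a , b) ≡ mirrorArc M (c , d) → (a , b) ≡ (c , d)
mirrorArc-injective (a≤M , b≤M) (c≤M , d≤M) eq =
  cong₂ _,_ (mirror-injective a≤M c≤M (cong proj₁ eq)) (mirror-injective b≤M d≤M (cong proj₂ eq))

∈-map-mirrorArc⁻ : ∀ {M a b xs} → (∀ {c d} → (c , d) ∈ xs → c ≤ M × d ≤ M) → a ≤ M × b ≤ M →
  mirrorArc M (a , b) ∈ map (mirrorArc M) xs → (a , b) ∈ xs
∈-map-mirrorArc⁻ xs≤M ab≤M = ∈-map⁻-injective λ { {_ , _} cd∈ → mirrorArc-injective (xs≤M cd∈) ab≤M }

mirror-IsVertexSet : ∀ {M p V} → (∀ {a} → a ∈ V → a ≤ M) → IsVertexSet p V → IsVertexSet p (map (mirror M) V)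
mirror-IsVertexSet {M} {V = V} V≤M (V! , |V|≡p) =
  Unique-map⁺-local (λ a∈ b∈ → mirror-injective (V≤M a∈) (V≤M b∈)) V! , trans (length-map (mirror M) V) |V|≡p

mirrorMember : ℕ → Member → Member
mirrorMember M F = member (map (mirrorArc M) (marcs F)) (λ a b → mirror M (mlab F (mirror M a) (mirror M b)))

module _ {p q σ : ℕ} {V : List ℕ} {F : Member} (Vp : IsVertexSet p V) (F∈ : InFamily V q σ F) where

  private
    |V|+|F|≡p+q : length V + length (marcs F) ≡ p + q
    |V|+|F|≡p+q = cong₂ _+_ (proj₂ Vp) (proj₁ (proj₂ F∈))

    label≤ : ∀ {x} → x ∈ map (λ a → a) V ++ arcLabels (memberDigraph V F) (memberLabeling F) → x ≤ p + q
    label≤ {x} x∈ = subst (x ≤_) |V|+|F|≡p+q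
                      (proj₂ (∈-interval⁻ (∈-resp-↭ (proj₁ (proj₂ (proj₂ F∈))) x∈)))

  InFamily⇒vertex≤ : ∀ {a} → a ∈ V → a ≤ p + q
  InFamily⇒vertex≤ a∈ = label≤ (∈-++⁺ˡ (∈-map⁺ _ a∈))

  InFamily⇒arcLabel≤ : ∀ {a b} → (a , b) ∈ marcs F → mlab F a b ≤ p + q
  InFamily⇒arcLabel≤ ab∈ = label≤ (∈-++⁺ʳ _ (∈-map⁺ _ ab∈))

  private
    P = p + q
    Vᶜ = map (mirror P) V
    Fᶜ = mirrorMember P F

    ends≤ : ∀ {a b} → (a , b) ∈ marcs F → a ≤ P × b ≤ P
    ends≤ ab∈ = let a∈ , b∈ = proj₂ (proj₂ (proj₁ F∈)) ab∈ in
      InFamily⇒vertex≤ a∈ , InFamily⇒vertex≤ b∈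

    mlab-mirror : ∀ {a b} → (a , b) ∈ marcs F → mlab Fᶜ (mirror P a) (mirror P b) ≡ mirror P (mlab F a b)
    mlab-mirror ab∈ = let a≤P , b≤P = ends≤ ab∈ in
      cong (mirror P) (cong₂ (mlab F) (mirror-involutive a≤P) (mirror-involutive b≤P))

    wellFormed : WellFormed (memberDigraph Vᶜ Fᶜ)
    wellFormed =
      proj₁ (mirror-IsVertexSet InFamily⇒vertex≤ Vp) ,
      Unique-map⁺-local (λ { {_ , _} {_ , _} ab∈ cd∈ → mirrorArc-injective (ends≤ ab∈) (ends≤ cd∈) })
                        (proj₁ (proj₂ (proj₁ F∈))) ,
      ends
      where
      ends : ∀ {x y} → (x , y) ∈ marcs Fᶜ → x ∈ Vᶜ × y ∈ Vᶜ
      ends xy∈ with ∈-map⁻ (mirrorArc P) xy∈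
      ... | (a , b) , ab∈ , refl = let a∈ , b∈ = proj₂ (proj₂ (proj₁ F∈)) ab∈ in
        ∈-map⁺ (mirror P) a∈ , ∈-map⁺ (mirror P) b∈

    labels-mirror :
      map (λ a → a) Vᶜ ++ arcLabels (memberDigraph Vᶜ Fᶜ) (memberLabeling Fᶜ)
      ≡ map (mirror P) (map (λ a → a) V ++ arcLabels (memberDigraph V F) (memberLabeling F))
    labels-mirror = begin
      map (λ a → a) Vᶜ ++ arcLabels (memberDigraph Vᶜ Fᶜ) (memberLabeling Fᶜ)
        ≡⟨ cong₂ _++_ (trans (map-id Vᶜ) (cong (map (mirror P)) (sym (map-id V)))) arcs-mirror ⟩
      map (mirror P) (map (λ a → a) V) ++ map (mirror P) (arcLabels (memberDigraph V F) (memberLabeling F))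
        ≡⟨ map-++ (mirror P) (map (λ a → a) V) _ ⟨
      map (mirror P) (map (λ a → a) V ++ arcLabels (memberDigraph V F) (memberLabeling F)) ∎
      where
      open ≡-Reasoning
      arcs-mirror : arcLabels (memberDigraph Vᶜ Fᶜ) (memberLabeling Fᶜ)
                    ≡ map (mirror P) (arcLabels (memberDigraph V F) (memberLabeling F))
      arcs-mirror = trans (sym (map-∘ (marcs F)))
        (trans (map-cong-local (All.tabulate λ { {_ , _} ab∈ → mlab-mirror ab∈ })) (map-∘ (marcs F)))

    size : length Vᶜ + length (marcs Fᶜ) ≡ P
    size = trans (cong₂ _+_ (length-map (mirror P) V) (length-map (mirrorArc P) (marcs F))) |V|+|F|≡p+q

    bijective : map (λ a → a) Vᶜ ++ arcLabels (memberDigraph Vᶜ Fᶜ) (memberLabeling Fᶜ)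
                ↭ interval 1 (length Vᶜ + length (marcs Fᶜ))
    bijective = begin
      map (λ a → a) Vᶜ ++ arcLabels (memberDigraph Vᶜ Fᶜ) (memberLabeling Fᶜ)        ≡⟨ labels-mirror ⟩
      map (mirror P) (map (λ a → a) V ++ arcLabels (memberDigraph V F) (memberLabeling F))
        ↭⟨ map⁺ (mirror P) (proj₁ (proj₂ (proj₂ F∈))) ⟩
      map (mirror P) (interval 1 (length V + length (marcs F)))
        ≡⟨ cong (λ m → map (mirror P) (interval 1 m)) |V|+|F|≡p+q ⟩
      map (mirror P) (interval 1 P) ↭⟨ map-mirror-interval P ⟩
      interval 1 P                  ≡⟨ cong (interval 1) size ⟨
      interval 1 (length Vᶜ + length (marcs Fᶜ)) ∎
      where open PermutationReasoning

    magic : ∀ {x y} → (x , y) ∈ marcs Fᶜ → x + mlab Fᶜ x y + y ≡ 3 * (P + 1) ∸ σ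
    magic xy∈ with ∈-map⁻ (mirrorArc P) xy∈
    ... | (a , b) , ab∈ , refl = let a≤P , b≤P = ends≤ ab∈ in
      trans (cong (λ m → mirror P a + m + mirror P b) (mlab-mirror ab∈))
            (mirror-magic a≤P (InFamily⇒arcLabel≤ ab∈) b≤P (proj₂ (proj₂ (proj₂ F∈)) ab∈))

  mirrorMember-InFamily : InFamily (map (mirror (p + q)) V) q (3 * (p + q + 1) ∸ σ) (mirrorMember (p + q) F)
  mirrorMember-InFamily =
    wellFormed , trans (length-map (mirrorArc P) (marcs F)) (proj₁ (proj₂ F∈)) , bijective , magic

module Product (n : ℕ) (E : List (ℕ × ℕ)) (V : List ℕ) (h : ℕ → ℕ → Member) where

  ∈-verts⁻ : ∀ {i a} → (i , a) ∈ verts (product n E V h) → i ∈ interval 1 n × a ∈ V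
  ∈-verts⁻ ia∈ with find (∈-concatMap⁻ _ ia∈)
  ... | i , i∈ , ia∈row with ∈-map⁻ (i ,_) ia∈row
  ... | _ , a∈ , refl = i∈ , a∈

  ∈-verts⁺ : ∀ {i a} → i ∈ interval 1 n → a ∈ V → (i , a) ∈ verts (product n E V h)
  ∈-verts⁺ i∈ a∈ = ∈-concatMap⁺ _ (lose i∈ (∈-map⁺ _ a∈))

  ∈-arcs⁻ : ∀ {i a j b} → ((i , a) , (j , b)) ∈ arcs (product n E V h) →
    (i , j) ∈ E × (a , b) ∈ marcs (h i j)
  ∈-arcs⁻ e∈ with find (∈-concatMap⁻ _ {xs = E} e∈)
  ... | (i , j) , ij∈ , e∈row with ∈-map⁻ (λ { (a , b) → (i , a) , (j , b) }) e∈row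
  ... | _ , ab∈ , refl = ij∈ , ab∈

  ∈-arcs⁺ : ∀ {i a j b} → (i , j) ∈ E → (a , b) ∈ marcs (h i j) →
    ((i , a) , (j , b)) ∈ arcs (product n E V h)
  ∈-arcs⁺ ij∈ ab∈ = ∈-concatMap⁺ _ (lose ij∈ (∈-map⁺ _ ab∈))

  size : ∀ {p q} → length V ≡ p → length E ≡ n → (∀ {i j} → (i , j) ∈ E → length (marcs (h i j)) ≡ q) →
    length (verts (product n E V h)) + length (arcs (product n E V h)) ≡ n * (p + q)
  size {p} {q} |V|≡p |E|≡n |h|≡q = begin
    length (verts (product n E V h)) + length (arcs (product n E V h))
      ≡⟨ cong₂ _+_ (length-concatMap _ (interval 1 n) λ _ → length-map _ V)
                   (length-concatMap _ E λ { {i , j} ij∈ → trans (length-map _ (marcs (h i j))) (|h|≡q ij∈) }) ⟩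
    length (interval 1 n) * length V + length E * q
      ≡⟨ cong₂ (λ m l → m * l + length E * q) (length-interval n) |V|≡p ⟩
    n * p + length E * q ≡⟨ cong (λ m → n * p + m * q) |E|≡n ⟩
    n * p + n * q        ≡⟨ *-distribˡ-+ n p q ⟨
    n * (p + q)          ∎
    where open ≡-Reasoning

module _ {n k : ℕ} {E : List (ℕ × ℕ)} (D : InS n k E) where

  InS-ends : ∀ {i j} → (i , j) ∈ E → (1 ≤ i × i ≤ n) × (1 ≤ j × j ≤ n)
  InS-ends ij∈ = let i∈ , j∈ = proj₂ (proj₂ (proj₁ D)) ij∈ in ∈-interval⁻ i∈ , ∈-interval⁻ j∈

  InS-k≤1+n : 1 ≤ n → k ≤ suc n
  InS-k≤1+n 1≤n with m≤n⇒∃[o]m+o≡n 1≤n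
  ... | m , refl with proj₂ (proj₂ (proj₂ D)) (k + m) (m≤m+n k m) (+-monoʳ-< k (n<1+n m))
  ... | i , j , ij∈ , i+j≡k+m = +-cancelʳ-≤ m k (suc (suc m)) (begin
    k + m             ≡⟨ i+j≡k+m ⟨
    i + j             ≤⟨ +-mono-≤ i≤n j≤n ⟩
    suc m + suc m     ≡⟨ +-suc (suc m) m ⟩
    suc (suc m) + m   ∎)
    where
    open ≤-Reasoning
    i≤n = proj₂ (proj₁ (InS-ends ij∈))
    j≤n = proj₂ (proj₂ (InS-ends ij∈))

-- The mirrored product D^c ⊗_{h^c} T

module Mirrored {n k : ℕ} {E : List (ℕ × ℕ)} (D : InS n k E)
                {p q σ : ℕ} {V : List ℕ} (Vp : IsVertexSet p V)
                {h : ℕ → ℕ → Member} (hT : ∀ {i j} → (i , j) ∈ E → InFamily V q σ (h i j))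
                (V≤ : ∀ {a} → a ∈ V → a ≤ p + q) where

  Vᶜ : List ℕ
  Vᶜ = map (mirror (p + q)) V

  hᶜ : ℕ → ℕ → Member
  hᶜ i j = mirrorMember (p + q) (h (mirror n i) (mirror n j))

  φ : ℕ × ℕ → ℕ × ℕ
  φ (i , a) = mirror n i , mirror (p + q) a

  private
    P = p + q
    G = product n E V h
    Gᶜ = product n (compArcs n E) Vᶜ hᶜ
    module ⊗ = Product n E V h
    module ⊗ᶜ = Product n (compArcs n E) Vᶜ hᶜ

    hᶜ-mirror : ∀ {i j} → i ≤ n → j ≤ n → hᶜ (mirror n i) (mirror n j) ≡ mirrorMember P (h i j)
    hᶜ-mirror i≤n j≤n =
      cong₂ (λ i j → mirrorMember P (h i j)) (mirror-involutive i≤n) (mirror-involutive j≤n)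

    E-ends≤ : ∀ {i j} → (i , j) ∈ E → i ≤ n × j ≤ n
    E-ends≤ ij∈ = let (_ , i≤n) , (_ , j≤n) = InS-ends D ij∈ in i≤n , j≤n

    arc-ends≤ : ∀ {i j a b} → (i , j) ∈ E → (a , b) ∈ marcs (h i j) → a ≤ P × b ≤ P
    arc-ends≤ ij∈ ab∈ = let a∈ , b∈ = proj₂ (proj₂ (proj₁ (hT ij∈))) ab∈ in V≤ a∈ , V≤ b∈

    vert-bounds : ∀ {i a} → (i , a) ∈ verts G → (1 ≤ i × i ≤ n) × a ≤ P
    vert-bounds ia∈ = let i∈ , a∈ = ⊗.∈-verts⁻ ia∈ in ∈-interval⁻ i∈ , V≤ a∈

  Vᶜ-IsVertexSet : IsVertexSet p Vᶜ
  Vᶜ-IsVertexSet = mirror-IsVertexSet V≤ Vp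

  hᶜ-InFamily : ∀ {i j} → (i , j) ∈ compArcs n E → InFamily Vᶜ q (3 * (p + q + 1) ∸ σ) (hᶜ i j)
  hᶜ-InFamily ij∈ with ∈-map⁻ (mirrorArc n) ij∈
  ... | (i , j) , ij∈E , refl = let i≤n , j≤n = E-ends≤ ij∈E in
    subst (InFamily Vᶜ q (3 * (P + 1) ∸ σ)) (sym (hᶜ-mirror i≤n j≤n)) (mirrorMember-InFamily Vp (hT ij∈E))

  φ-IsIso : IsIso G Gᶜ φ
  φ-IsIso = into , injective , surjective , λ ia∈ jb∈ → arcs-into ia∈ jb∈ , arcs-from ia∈ jb∈
    where
    into : ∀ {x} → x ∈ verts G → φ x ∈ verts Gᶜ
    into {_ , _} ia∈ = let i∈ , a∈ = ⊗.∈-verts⁻ ia∈ in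
      ⊗ᶜ.∈-verts⁺ (mirror-∈-interval i∈) (∈-map⁺ (mirror P) a∈)

    injective : ∀ {x y} → x ∈ verts G → y ∈ verts G → φ x ≡ φ y → x ≡ y
    injective {_ , _} {_ , _} ia∈ jb∈ eq =
      let (_ , i≤n) , a≤P = vert-bounds ia∈ ; (_ , j≤n) , b≤P = vert-bounds jb∈ in
      cong₂ _,_ (mirror-injective i≤n j≤n (cong proj₁ eq)) (mirror-injective a≤P b≤P (cong proj₂ eq))

    surjective : ∀ {y} → y ∈ verts Gᶜ → ∃[ x ] (x ∈ verts G × φ x ≡ y)
    surjective {i , _} ia′∈ with ⊗ᶜ.∈-verts⁻ ia′∈
    ... | i∈ , a′∈ with ∈-map⁻ (mirror P) a′∈
    ... | a , a∈ , refl = (mirror n i , a) , ⊗.∈-verts⁺ (mirror-∈-interval i∈) a∈ ,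
                          cong (_, mirror P a) (mirror-involutive (proj₂ (∈-interval⁻ i∈)))

    arcs-into : ∀ {x y} → x ∈ verts G → y ∈ verts G → (x , y) ∈ arcs G → (φ x , φ y) ∈ arcs Gᶜ
    arcs-into {i , a} {j , b} ia∈ jb∈ e∈ =
      let ij∈ , ab∈ = ⊗.∈-arcs⁻ e∈ ; (_ , i≤n) , _ = vert-bounds ia∈ ; (_ , j≤n) , _ = vert-bounds jb∈ in
      ⊗ᶜ.∈-arcs⁺ (∈-map⁺ (mirrorArc n) ij∈)
        (subst (λ F → mirrorArc P (a , b) ∈ marcs F) (sym (hᶜ-mirror i≤n j≤n)) (∈-map⁺ (mirrorArc P) ab∈))

    arcs-from : ∀ {x y} → x ∈ verts G → y ∈ verts G → (φ x , φ y) ∈ arcs Gᶜ → (x , y) ∈ arcs G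
    arcs-from {i , a} {j , b} ia∈ jb∈ e∈ =
      let ij∈ᶜ , ab∈ᶜ = ⊗ᶜ.∈-arcs⁻ e∈ ; (_ , i≤n) , a≤P = vert-bounds ia∈ ; (_ , j≤n) , b≤P = vert-bounds jb∈
          ij∈ = ∈-map-mirrorArc⁻ E-ends≤ (i≤n , j≤n) ij∈ᶜ in
      ⊗.∈-arcs⁺ ij∈
        (∈-map-mirrorArc⁻ (arc-ends≤ ij∈) (a≤P , b≤P)
          (subst (λ F → mirrorArc P (a , b) ∈ marcs F) (hᶜ-mirror i≤n j≤n) ab∈ᶜ))

  φ-Carries : Carries G φ (complement G (induced n k p q σ)) (induced n (n + 3 ∸ k) p q (3 * (p + q + 1) ∸ σ))
  φ-Carries = vertex-labels , arc-labels
    where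
    open ≡-Reasoning

    resize : ∀ z → mirror (n * P) z ≡ mirror (length (verts G) + length (arcs G)) z
    resize z = cong (λ L → mirror L z) (sym (⊗.size (proj₂ Vp) (proj₁ (proj₂ D)) (λ ij∈ → proj₁ (proj₂ (hT ij∈)))))

    vertex-labels : ∀ {x} → x ∈ verts G →
      vlab (induced n (n + 3 ∸ k) p q (3 * (P + 1) ∸ σ)) (φ x) ≡ vlab (complement G (induced n k p q σ)) x
    vertex-labels {i , a} ia∈ = let (1≤i , i≤n) , a≤P = vert-bounds ia∈ in begin
      P * (mirror n i ∸ 1) + mirror P a ≡⟨ mirror-block 1≤i i≤n a≤P ⟨
      mirror (n * P) (P * (i ∸ 1) + a)  ≡⟨ resize (P * (i ∸ 1) + a) ⟩
      mirror (length (verts G) + length (arcs G)) (P * (i ∸ 1) + a) ∎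

    arc-labels : ∀ {x y} → (x , y) ∈ arcs G →
      alab (induced n (n + 3 ∸ k) p q (3 * (P + 1) ∸ σ)) (φ x) (φ y)
      ≡ alab (complement G (induced n k p q σ)) x y
    arc-labels {i , a} {j , b} e∈ = begin
      P * (n + 3 ∸ k + n ∸ (mirror n i + mirror n j) ∸ 1) + (3 * (P + 1) ∸ σ ∸ (mirror P a + mirror P b))
        ≡⟨ cong₂ (λ x y → P * (x ∸ 1) + y)
                 (mirror-arcIndex i≤n j≤n k≤n+3 k≤i+j (<⇒≤ i+j<k+n))
                 (m+n+o≡p⇒p∸[m+o]≡n {mirror P a} {mirror P m} {mirror P b} (mirror-magic a≤P m≤P b≤P magic)) ⟩
      P * (mirror n x ∸ 1) + mirror P m ≡⟨ mirror-block 1≤x x≤n m≤P ⟨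
      mirror (n * P) (P * (x ∸ 1) + m)
        ≡⟨ cong (λ y → mirror (n * P) (P * (x ∸ 1) + y)) (m+n+o≡p⇒p∸[m+o]≡n {a} {m} {b} magic) ⟨
      mirror (n * P) (P * (x ∸ 1) + (σ ∸ (a + b))) ≡⟨ resize (P * (x ∸ 1) + (σ ∸ (a + b))) ⟩
      mirror (length (verts G) + length (arcs G)) (P * (x ∸ 1) + (σ ∸ (a + b))) ∎
      where
      ij∈ = proj₁ (⊗.∈-arcs⁻ e∈)
      ab∈ = proj₂ (⊗.∈-arcs⁻ e∈)
      m = mlab (h i j) a b
      x = k + n ∸ (i + j)
      magic = proj₂ (proj₂ (proj₂ (hT ij∈))) ab∈
      m≤P = InFamily⇒arcLabel≤ Vp (hT ij∈) ab∈
      a≤P = proj₁ (arc-ends≤ ij∈ ab∈)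
      b≤P = proj₂ (arc-ends≤ ij∈ ab∈)
      1≤i = proj₁ (proj₁ (InS-ends D ij∈))
      i≤n = proj₁ (E-ends≤ ij∈)
      j≤n = proj₂ (E-ends≤ ij∈)
      k≤i+j = proj₁ (proj₁ (proj₂ (proj₂ D)) ij∈)
      i+j<k+n = proj₂ (proj₁ (proj₂ (proj₂ D)) ij∈)
      k≤n+3 = ≤-trans (InS-k≤1+n D (≤-trans 1≤i i≤n))
                      (≤-trans (≤-reflexive (+-comm 1 n)) (+-monoʳ-≤ n (s≤s z≤n)))
      1≤x = proj₁ (arcIndex-bounds k≤i+j i+j<k+n)
      x≤n = proj₂ (arcIndex-bounds k≤i+j i+j<k+n)

proposition3p3 :
    (n k : ℕ) (E : List (ℕ × ℕ)) → InS n k E →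
    (p q σ : ℕ) (V : List ℕ) → IsVertexSet p V →
    (h : ℕ → ℕ → Member) → (∀ {i j} → (i , j) ∈ E → InFamily V q σ (h i j)) →
    ∃[ V′ ] (IsVertexSet p V′ ×
      ∃[ hc ] ((∀ {i j} → (i , j) ∈ compArcs n E →
                  InFamily V′ q (3 * (p + q + 1) ∸ σ) (hc i j)) ×
        ∃[ φ ] (IsIso (product n E V h) (product n (compArcs n E) V′ hc) φ ×
          Carries (product n E V h) φ
            (complement (product n E V h) (induced n k p q σ))
            (induced n (n + 3 ∸ k) p q (3 * (p + q + 1) ∸ σ)))))
-- Without arcs nothing confines V to [1, p+q], so V cannot be mirrored; but then n = 0 and both
-- products are empty.
proposition3p3 n k [] D p q σ V Vp h hT with proj₁ (proj₂ D)
... | refl = V , Vp , h , (λ ()) , (λ x → x) , ((λ ()) , (λ ()) , (λ ()) , (λ ())) , ((λ ()) , (λ ()))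
proposition3p3 n k (_ ∷ _) D p q σ V Vp h hT =
  Vᶜ , Vᶜ-IsVertexSet , hᶜ , hᶜ-InFamily , φ , φ-IsIso , φ-Carries
  where open Mirrored D Vp hT (InFamily⇒vertex≤ Vp (hT (here refl)))
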